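{- Let $\circ\alpha=\Delta\alpha\vee\Delta\neg\alpha$ and $\bullet\alpha=\neg\circ\alpha$. In $\mathbf{Six}$: (i) $\alpha\wedge\neg\alpha\models_{\mathbf{Six}}\bullet\alpha$ for every formula $\alpha$, but for a propositional variable $p$, $\bullet p\not\models_{\mathbf{Six}}p\wedge\neg p$; (ii) for every formula $\alpha$, $\bullet\alpha\models_{\mathbf{Six}}\bullet\neg\alpha$ and $\bullet\neg\alpha\models_{\mathbf{Six}}\bullet\alpha$; (iii) for all formulas $\alpha,\beta$ and $\#\in\{\wedge,\vee\}$, $\bullet(\alpha\#\beta)\models_{\mathbf{Six}}\bullet\alpha\vee\bullet\beta$, while the converse does not hold in general: for each $\#\in\{\wedge,\vee\}$ there are formulas $\alpha,\beta$ with $\bullet\alpha\vee\bullet\beta\not\models_{\mathbf{Six}}\bullet(\alpha\#\beta)$.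
   Context: An involutive Stone algebra is a De Morgan algebra (bounded distributive lattice with $\neg\neg x=x$, $\neg(x\wedge y)=\neg x\vee\neg y$) with a unary $\nabla$ satisfying $\nabla0=0$, $a\wedge\nabla a=a$, $\nabla(a\wedge b)=\nabla a\wedge\nabla b$, $\neg\nabla a\wedge\nabla a=0$; the class is $\mathbf S$. $Fm$ is the set of formulas over a denumerable set of propositional variables built from binary $\wedge,\vee$, unary $\neg,\nabla$ and constants $\bot,\top$; homomorphisms send $\bot\mapsto0,\top\mapsto1$. $\Delta\alpha$ abbreviates $\neg\nabla\neg\alpha$. The logic $\mathbf{Six}$: for nonempty finite premises, $\alpha_1,\dots,\alpha_n\models_{\mathbf{Six}}\alpha$ iff for every $A\in\mathbf S$, every homomorphism $v:\mathfrak{Fm}\to A$ and every $a\in A$, if $v(\alpha_i)\ge a$ for all $i$ then $v(\alpha)\ge a$. -}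

module Defs where

open import Level using (Level; _⊔_; suc)
open import Data.Nat using (ℕ)
open import Data.List.NonEmpty using (List⁺; _∷_)
open import Data.List using ([])
open import Data.List.Relation.Unary.All using (All)
open import Data.Product using (_×_)
open import Relation.Binary.Core using (Rel)
open import Algebra.Core using (Op₁; Op₂)
open import Algebra.Definitions using (Congruent₁; LeftIdentity)
open import Algebra.Lattice.Structures using (IsDistributiveLattice)

record InvolutiveStoneAlgebra (c ℓ : Level) : Set (suc (c ⊔ ℓ)) where
  infix  4 _≈_ _≤_
  infixr 6 _∨_
  infixr 7 _∧_
  field
    Carrier : Set c
    _≈_     : Rel Carrier ℓ
    _∨_     : Op₂ Carrier
    _∧_     : Op₂ Carrier
    ¬_      : Op₁ Carrier
    ∇       : Op₁ Carrier
    0#      : Carrier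
    1#      : Carrier
    isDistributiveLattice : IsDistributiveLattice _≈_ _∨_ _∧_
    ∨-identityˡ : LeftIdentity _≈_ 0# _∨_
    ∧-identityˡ : LeftIdentity _≈_ 1# _∧_
    ¬-cong : Congruent₁ _≈_ ¬_
    ∇-cong : Congruent₁ _≈_ ∇
    ¬-involutive : ∀ x → ¬ (¬ x) ≈ x
    deMorgan     : ∀ x y → ¬ (x ∧ y) ≈ (¬ x) ∨ (¬ y)
    ∇-0    : ∇ 0# ≈ 0#
    ∇-incr : ∀ a → a ∧ ∇ a ≈ a
    ∇-∧    : ∀ a b → ∇ (a ∧ b) ≈ ∇ a ∧ ∇ b
    ∇-comp : ∀ a → (¬ (∇ a)) ∧ ∇ a ≈ 0#

  open IsDistributiveLattice isDistributiveLattice public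

  _≤_ : Rel Carrier ℓ
  a ≤ b = a ∧ b ≈ a

infixr 6 _∨ᶠ_
infixr 7 _∧ᶠ_

data Fm : Set where
  var    : ℕ → Fm
  _∧ᶠ_   : Fm → Fm → Fm
  _∨ᶠ_   : Fm → Fm → Fm
  ¬ᶠ_    : Fm → Fm
  ∇ᶠ     : Fm → Fm
  ⊥ᶠ ⊤ᶠ  : Fm

Δᶠ : Fm → Fm
Δᶠ α = ¬ᶠ (∇ᶠ (¬ᶠ α))

∘ᶠ : Fm → Fm
∘ᶠ α = Δᶠ α ∨ᶠ Δᶠ (¬ᶠ α)

•ᶠ : Fm → Fm
•ᶠ α = ¬ᶠ (∘ᶠ α)

-- Homomorphisms Fm → A are exactly the unique extensions of assignments
-- of the variables; this is that extension.
module _ {c ℓ} (A : InvolutiveStoneAlgebra c ℓ) where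
  open InvolutiveStoneAlgebra A

  ⟦_⟧ : Fm → (ℕ → Carrier) → Carrier
  ⟦ var n ⟧   v = v n
  ⟦ α ∧ᶠ β ⟧  v = ⟦ α ⟧ v ∧ ⟦ β ⟧ v
  ⟦ α ∨ᶠ β ⟧  v = ⟦ α ⟧ v ∨ ⟦ β ⟧ v
  ⟦ ¬ᶠ α ⟧    v = ¬ (⟦ α ⟧ v)
  ⟦ ∇ᶠ α ⟧    v = ∇ (⟦ α ⟧ v)
  ⟦ ⊥ᶠ ⟧      v = 0#
  ⟦ ⊤ᶠ ⟧      v = 1#

SixEntails : (c ℓ : Level) → List⁺ Fm → Fm → Set (suc (c ⊔ ℓ))
SixEntails c ℓ Γ φ =
  (A : InvolutiveStoneAlgebra c ℓ) →
  let open InvolutiveStoneAlgebra A in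
  (v : ℕ → Carrier) (a : Carrier) →
  All (λ ψ → a ≤ ⟦ A ⟧ ψ v) (Data.List.NonEmpty.toList Γ) →
  a ≤ ⟦ A ⟧ φ v

_⊨[_,_]_ : Fm → (c ℓ : Level) → Fm → Set (suc (c ⊔ ℓ))
α ⊨[ c , ℓ ] β = SixEntails c ℓ (α ∷ []) β

module Submission where

-- In an involutive Stone algebra ∇ is inflationary, monotone and meet-preserving, and ∇ x has
-- the complement ¬ ∇ x; splitting along that complement shows ∇ (x ∨ y) ≤ ∇ x ∨ ∇ y. With
-- De Morgan this gives • x = ∇ x ∧ ∇ ¬ x, and the valid entailments of (i)–(iii) become
-- lattice inequalities between such meets. All failures are witnessed in the three-element
-- Kleene chain 0 < ½ < 1 with ¬ ½ = ½ and ∇ ½ = 1: there • ½ = 1, whereas ½ ∧ ¬ ½ = ½,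
-- • (½ ∧ 0) = • 0 = 0 and • (½ ∨ 1) = • 1 = 0.

open import Defs
open import Level using (Level; Lift; lift; lower)
open import Data.Nat using (ℕ)
open import Data.Product using (_×_; Σ-syntax; _,_)
open import Relation.Nullary using (¬_)
open import Data.List.Relation.Unary.All using (_∷_; [])
open import Data.Fin using (Fin; zero; suc; opposite; _≟_)
open import Data.Fin.Properties using (all?)
open import Relation.Nullary.Decidable using (from-yes)
open import Relation.Binary.PropositionalEquality as ≡ using (_≡_; _≢_)
open import Algebra.Lattice.Bundles using (Lattice)
import Algebra.Lattice.Properties.Lattice as LatticeProperties
import Relation.Binary.Lattice as OrderTheoretic
import Relation.Binary.Lattice.Properties.MeetSemilattice as MeetProperties
import Relation.Binary.Lattice.Properties.JoinSemilattice as JoinProperties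
import Relation.Binary.Reasoning.PartialOrder as ≤-Reasoning

module InvolutiveStoneAlgebraProperties {c ℓ} (A : InvolutiveStoneAlgebra c ℓ) where
  open InvolutiveStoneAlgebra A hiding (_≤_) renaming (¬_ to ~_)

  lattice : Lattice c ℓ
  lattice = record { isLattice = isLattice }

  orderLattice : OrderTheoretic.Lattice c ℓ ℓ
  orderLattice = LatticeProperties.∨-∧-orderTheoreticLattice lattice

  open OrderTheoretic.Lattice orderLattice public
    using (_≤_; poset; y≤x∨y; ∨-least; x∧y≤x; x∧y≤y; ∧-greatest)
  open OrderTheoretic.Lattice orderLattice public
    using () renaming (refl to ≤-refl; reflexive to ≤-reflexive; trans to ≤-trans)
  open MeetProperties (OrderTheoretic.Lattice.meetSemilattice orderLattice) using (∧-monotonic)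
  open JoinProperties (OrderTheoretic.Lattice.joinSemilattice orderLattice) using (∨-monotonic)
  open ≤-Reasoning poset

  private variable x y u v w : Carrier

  0≤x : 0# ≤ x
  0≤x {x} = sym (begin-equality
    0# ∧ x          ≈⟨ ∧-congˡ (∨-identityˡ x) ⟨
    0# ∧ (0# ∨ x)   ≈⟨ ∧-absorbs-∨ 0# x ⟩
    0#              ∎)

  x≤1 : x ≤ 1#
  x≤1 {x} = sym (trans (∧-comm x 1#) (∧-identityˡ x))

  ~-antitone : x ≤ y → ~ y ≤ ~ x
  ~-antitone {x} {y} x≤y = begin
    ~ y        ≤⟨ y≤x∨y (~ x) (~ y) ⟩
    ~ x ∨ ~ y  ≈⟨ deMorgan x y ⟨
    ~ (x ∧ y)  ≈⟨ ¬-cong x≤y ⟨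
    ~ x        ∎

  ~-∨ : ∀ x y → ~ (x ∨ y) ≈ ~ x ∧ ~ y
  ~-∨ x y = begin-equality
    ~ (x ∨ y)            ≈⟨ ¬-cong (∨-cong (¬-involutive x) (¬-involutive y)) ⟨
    ~ (~ ~ x ∨ ~ ~ y)    ≈⟨ ¬-cong (deMorgan (~ x) (~ y)) ⟨
    ~ ~ (~ x ∧ ~ y)      ≈⟨ ¬-involutive (~ x ∧ ~ y) ⟩
    ~ x ∧ ~ y            ∎

  x≤∇x : x ≤ ∇ x
  x≤∇x {x} = sym (∇-incr x)

  ∇-monotone : x ≤ y → ∇ x ≤ ∇ y
  ∇-monotone {x} {y} x≤y = trans (∇-cong x≤y) (∇-∧ x y)

  ∇x∧~∇x≤0 : ∀ x → ∇ x ∧ ~ ∇ x ≤ 0#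
  ∇x∧~∇x≤0 x = ≤-reflexive (trans (∧-comm (∇ x) (~ ∇ x)) (∇-comp x))

  1≤∇x∨~∇x : ∀ x → 1# ≤ ∇ x ∨ ~ ∇ x
  1≤∇x∨~∇x x = begin
    1#                   ≈⟨ ¬-involutive 1# ⟨
    ~ ~ 1#               ≤⟨ ~-antitone 0≤x ⟩
    ~ 0#                 ≤⟨ ~-antitone (∇x∧~∇x≤0 x) ⟩
    ~ (∇ x ∧ ~ ∇ x)      ≈⟨ deMorgan (∇ x) (~ ∇ x) ⟩
    ~ ∇ x ∨ ~ ~ ∇ x      ≈⟨ ∨-comm (~ ∇ x) (~ ~ ∇ x) ⟩
    ~ ~ ∇ x ∨ ~ ∇ x      ≈⟨ ∨-congʳ (¬-involutive (∇ x)) ⟩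
    ∇ x ∨ ~ ∇ x          ∎

  ≤∇u∨v : w ∧ ~ ∇ u ≤ v → w ≤ ∇ u ∨ v
  ≤∇u∨v {w} {u} {v} w∧~∇u≤v = begin
    w                           ≤⟨ ∧-greatest ≤-refl (≤-trans x≤1 (1≤∇x∨~∇x u)) ⟩
    w ∧ (∇ u ∨ ~ ∇ u)           ≈⟨ ∧-distribˡ-∨ w (∇ u) (~ ∇ u) ⟩
    (w ∧ ∇ u) ∨ (w ∧ ~ ∇ u)     ≤⟨ ∨-monotonic (x∧y≤y w (∇ u)) w∧~∇u≤v ⟩
    ∇ u ∨ v                     ∎

  ∇[x∨y]≤∇x∨∇y : ∀ x y → ∇ (x ∨ y) ≤ ∇ x ∨ ∇ y
  ∇[x∨y]≤∇x∨∇y x y = ≤∇u∨v (begin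
    ∇ (x ∨ y) ∧ ~ ∇ x           ≤⟨ ∧-monotonic ≤-refl x≤∇x ⟩
    ∇ (x ∨ y) ∧ ∇ (~ ∇ x)       ≈⟨ ∇-∧ (x ∨ y) (~ ∇ x) ⟨
    ∇ ((x ∨ y) ∧ ~ ∇ x)         ≤⟨ ∇-monotone [x∨y]∧~∇x≤y ⟩
    ∇ y                         ∎)
    where
    [x∨y]∧~∇x≤y : (x ∨ y) ∧ ~ ∇ x ≤ y
    [x∨y]∧~∇x≤y = begin
      (x ∨ y) ∧ ~ ∇ x               ≈⟨ ∧-distribʳ-∨ (~ ∇ x) x y ⟩
      (x ∧ ~ ∇ x) ∨ (y ∧ ~ ∇ x)     ≤⟨ ∨-least (≤-trans (∧-monotonic x≤∇x ≤-refl)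
                                         (≤-trans (∇x∧~∇x≤0 x) 0≤x)) (x∧y≤x y (~ ∇ x)) ⟩
      y                             ∎

  [x∧y]∧[u∨v]≤[x∧u]∨[y∧v] : ∀ x y u v → (x ∧ y) ∧ (u ∨ v) ≤ (x ∧ u) ∨ (y ∧ v)
  [x∧y]∧[u∨v]≤[x∧u]∨[y∧v] x y u v = begin
    (x ∧ y) ∧ (u ∨ v)               ≈⟨ ∧-distribˡ-∨ (x ∧ y) u v ⟩
    ((x ∧ y) ∧ u) ∨ ((x ∧ y) ∧ v)   ≤⟨ ∨-monotonic (∧-monotonic (x∧y≤x x y) ≤-refl)
                                                   (∧-monotonic (x∧y≤y x y) ≤-refl) ⟩
    (x ∧ u) ∨ (y ∧ v)               ∎

  -- Copies of Δᶠ, ∘ᶠ, •ᶠ, so that ⟦ A ⟧ (•ᶠ α) v reduces to • (⟦ A ⟧ α v).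
  Δ : Carrier → Carrier
  Δ x = ~ ∇ (~ x)

  ∘ : Carrier → Carrier
  ∘ x = Δ x ∨ Δ (~ x)

  • : Carrier → Carrier
  • x = ~ ∘ x

  •x≈∇x∧∇~x : ∀ x → • x ≈ ∇ x ∧ ∇ (~ x)
  •x≈∇x∧∇~x x = begin-equality
    ~ (~ ∇ (~ x) ∨ ~ ∇ (~ ~ x))     ≈⟨ ~-∨ (~ ∇ (~ x)) (~ ∇ (~ ~ x)) ⟩
    ~ ~ ∇ (~ x) ∧ ~ ~ ∇ (~ ~ x)     ≈⟨ ∧-cong (¬-involutive _) (¬-involutive _) ⟩
    ∇ (~ x) ∧ ∇ (~ ~ x)             ≈⟨ ∧-congˡ (∇-cong (¬-involutive x)) ⟩
    ∇ (~ x) ∧ ∇ x                   ≈⟨ ∧-comm (∇ (~ x)) (∇ x) ⟩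
    ∇ x ∧ ∇ (~ x)                   ∎

  x∧~x≤•x : ∀ x → x ∧ ~ x ≤ • x
  x∧~x≤•x x = begin
    x ∧ ~ x          ≤⟨ ∧-monotonic x≤∇x x≤∇x ⟩
    ∇ x ∧ ∇ (~ x)    ≈⟨ •x≈∇x∧∇~x x ⟨
    • x              ∎

  •~x≈•x : ∀ x → • (~ x) ≈ • x
  •~x≈•x x = begin-equality
    • (~ x)              ≈⟨ •x≈∇x∧∇~x (~ x) ⟩
    ∇ (~ x) ∧ ∇ (~ ~ x)  ≈⟨ ∧-congˡ (∇-cong (¬-involutive x)) ⟩
    ∇ (~ x) ∧ ∇ x        ≈⟨ ∧-comm (∇ (~ x)) (∇ x) ⟩
    ∇ x ∧ ∇ (~ x)        ≈⟨ •x≈∇x∧∇~x x ⟨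
    • x                  ∎

  •[x∧y]≤•x∨•y : ∀ x y → • (x ∧ y) ≤ • x ∨ • y
  •[x∧y]≤•x∨•y x y = begin
    • (x ∧ y)                           ≈⟨ •x≈∇x∧∇~x (x ∧ y) ⟩
    ∇ (x ∧ y) ∧ ∇ (~ (x ∧ y))           ≈⟨ ∧-cong (∇-∧ x y) (∇-cong (deMorgan x y)) ⟩
    (∇ x ∧ ∇ y) ∧ ∇ (~ x ∨ ~ y)         ≤⟨ ∧-monotonic ≤-refl (∇[x∨y]≤∇x∨∇y (~ x) (~ y)) ⟩
    (∇ x ∧ ∇ y) ∧ (∇ (~ x) ∨ ∇ (~ y))   ≤⟨ [x∧y]∧[u∨v]≤[x∧u]∨[y∧v] _ _ _ _ ⟩
    (∇ x ∧ ∇ (~ x)) ∨ (∇ y ∧ ∇ (~ y))   ≈⟨ ∨-cong (•x≈∇x∧∇~x x) (•x≈∇x∧∇~x y) ⟨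
    • x ∨ • y                           ∎

  •[x∨y]≤•x∨•y : ∀ x y → • (x ∨ y) ≤ • x ∨ • y
  •[x∨y]≤•x∨•y x y = begin
    • (x ∨ y)                           ≈⟨ •x≈∇x∧∇~x (x ∨ y) ⟩
    ∇ (x ∨ y) ∧ ∇ (~ (x ∨ y))           ≈⟨ ∧-comm _ _ ⟩
    ∇ (~ (x ∨ y)) ∧ ∇ (x ∨ y)           ≈⟨ ∧-congʳ (trans (∇-cong (~-∨ x y)) (∇-∧ (~ x) (~ y))) ⟩
    (∇ (~ x) ∧ ∇ (~ y)) ∧ ∇ (x ∨ y)     ≤⟨ ∧-monotonic ≤-refl (∇[x∨y]≤∇x∨∇y x y) ⟩
    (∇ (~ x) ∧ ∇ (~ y)) ∧ (∇ x ∨ ∇ y)   ≤⟨ [x∧y]∧[u∨v]≤[x∧u]∨[y∧v] _ _ _ _ ⟩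
    (∇ (~ x) ∧ ∇ x) ∨ (∇ (~ y) ∧ ∇ y)   ≈⟨ ∨-cong (∧-comm _ _) (∧-comm _ _) ⟩
    (∇ x ∧ ∇ (~ x)) ∨ (∇ y ∧ ∇ (~ y))   ≈⟨ ∨-cong (•x≈∇x∧∇~x x) (•x≈∇x∧∇~x y) ⟨
    • x ∨ • y                           ∎

module _ {c ℓ : Level} where

  -- Defs orders by a ∧ b ≈ a, the stdlib natural order by a ≈ a ∧ b.
  ≤⇒⊨ : (α β : Fm) →
    ((A : InvolutiveStoneAlgebra c ℓ) (v : ℕ → InvolutiveStoneAlgebra.Carrier A) →
      let open InvolutiveStoneAlgebraProperties A in ⟦ A ⟧ α v ≤ ⟦ A ⟧ β v) →
    α ⊨[ c , ℓ ] β
  ≤⇒⊨ α β α≤β A v a (a∧α≈a ∷ []) = sym (≤-trans (sym a∧α≈a) (α≤β A v))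
    where open InvolutiveStoneAlgebraProperties A
          open InvolutiveStoneAlgebra A using (sym)

  ⊭-by-valuation : (α β : Fm) (A : InvolutiveStoneAlgebra c ℓ)
    (v : ℕ → InvolutiveStoneAlgebra.Carrier A) →
    let open InvolutiveStoneAlgebra A using (_≈_; 1#) in
    ⟦ A ⟧ α v ≈ 1# → ¬ ⟦ A ⟧ β v ≈ 1# → ¬ α ⊨[ c , ℓ ] β
  ⊭-by-valuation α β A v α≈1 β≉1 α⊨β =
    β≉1 (trans (sym (∧-identityˡ _)) (α⊨β A v 1# (trans (∧-identityˡ _) α≈1 ∷ [])))
    where open InvolutiveStoneAlgebra A using (trans; sym; ∧-identityˡ; 1#)

module ThreeElementChain where
  pattern 0₃ = zero
  pattern ½  = suc zero
  pattern 1₃ = suc (suc zero)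

  infixr 6 _⊔_
  infixr 7 _⊓_

  _⊓_ : Fin 3 → Fin 3 → Fin 3
  0₃ ⊓ y  = 0₃
  ½  ⊓ 0₃ = 0₃
  ½  ⊓ y  = ½
  1₃ ⊓ y  = y

  _⊔_ : Fin 3 → Fin 3 → Fin 3
  0₃ ⊔ y  = y
  ½  ⊔ 1₃ = 1₃
  ½  ⊔ y  = ½
  1₃ ⊔ y  = 1₃

  ∇₃ : Fin 3 → Fin 3
  ∇₃ 0₃ = 0₃
  ∇₃ _  = 1₃

  K₃ : (c ℓ : Level) → InvolutiveStoneAlgebra c ℓ
  K₃ c ℓ = record
    { Carrier = Lift c (Fin 3)
    ; _≈_     = λ x y → Lift ℓ (lower x ≡ lower y)
    ; _∨_     = λ x y → lift (lower x ⊔ lower y)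
    ; _∧_     = λ x y → lift (lower x ⊓ lower y)
    ; ¬_      = λ x → lift (opposite (lower x))
    ; ∇       = λ x → lift (∇₃ (lower x))
    ; 0#      = lift 0₃
    ; 1#      = lift 1₃
    ; isDistributiveLattice = record
      { isLattice = record
        { isEquivalence = record
          { refl  = lift ≡.refl
          ; sym   = λ (lift p) → lift (≡.sym p)
          ; trans = λ (lift p) (lift q) → lift (≡.trans p q)
          }
        ; ∨-comm     = λ x y → lift (⊔-comm (lower x) (lower y))
        ; ∨-assoc    = λ x y z → lift (⊔-assoc (lower x) (lower y) (lower z))
        ; ∨-cong     = λ (lift p) (lift q) → lift (≡.cong₂ _⊔_ p q)
        ; ∧-comm     = λ x y → lift (⊓-comm (lower x) (lower y))
        ; ∧-assoc    = λ x y z → lift (⊓-assoc (lower x) (lower y) (lower z))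
        ; ∧-cong     = λ (lift p) (lift q) → lift (≡.cong₂ _⊓_ p q)
        ; absorptive = (λ x y → lift (⊔-absorbs-⊓ (lower x) (lower y)))
                     , (λ x y → lift (⊓-absorbs-⊔ (lower x) (lower y)))
        }
      ; ∨-distrib-∧ = (λ x y z → lift (⊔-distribˡ-⊓ (lower x) (lower y) (lower z)))
                    , (λ x y z → lift (⊔-distribʳ-⊓ (lower x) (lower y) (lower z)))
      ; ∧-distrib-∨ = (λ x y z → lift (⊓-distribˡ-⊔ (lower x) (lower y) (lower z)))
                    , (λ x y z → lift (⊓-distribʳ-⊔ (lower x) (lower y) (lower z)))
      }
    ; ∨-identityˡ  = λ _ → lift ≡.refl
    ; ∧-identityˡ  = λ _ → lift ≡.refl
    ; ¬-cong       = λ (lift p) → lift (≡.cong opposite p)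
    ; ∇-cong       = λ (lift p) → lift (≡.cong ∇₃ p)
    ; ¬-involutive = λ x → lift (opposite-involutive (lower x))
    ; deMorgan     = λ x y → lift (opposite-⊓ (lower x) (lower y))
    ; ∇-0          = lift ≡.refl
    ; ∇-incr       = λ x → lift (x⊓∇₃x≡x (lower x))
    ; ∇-∧          = λ x y → lift (∇₃-⊓ (lower x) (lower y))
    ; ∇-comp       = λ x → lift (opposite∇₃x⊓∇₃x≡0 (lower x))
    }
    where
    ⊔-comm : ∀ x y → x ⊔ y ≡ y ⊔ x
    ⊔-comm = from-yes (all? λ x → all? λ y → x ⊔ y ≟ y ⊔ x)
    ⊓-comm : ∀ x y → x ⊓ y ≡ y ⊓ x
    ⊓-comm = from-yes (all? λ x → all? λ y → x ⊓ y ≟ y ⊓ x)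
    ⊔-assoc : ∀ x y z → (x ⊔ y) ⊔ z ≡ x ⊔ (y ⊔ z)
    ⊔-assoc = from-yes (all? λ x → all? λ y → all? λ z → (x ⊔ y) ⊔ z ≟ x ⊔ (y ⊔ z))
    ⊓-assoc : ∀ x y z → (x ⊓ y) ⊓ z ≡ x ⊓ (y ⊓ z)
    ⊓-assoc = from-yes (all? λ x → all? λ y → all? λ z → (x ⊓ y) ⊓ z ≟ x ⊓ (y ⊓ z))
    ⊔-absorbs-⊓ : ∀ x y → x ⊔ x ⊓ y ≡ x
    ⊔-absorbs-⊓ = from-yes (all? λ x → all? λ y → x ⊔ x ⊓ y ≟ x)
    ⊓-absorbs-⊔ : ∀ x y → x ⊓ (x ⊔ y) ≡ x
    ⊓-absorbs-⊔ = from-yes (all? λ x → all? λ y → x ⊓ (x ⊔ y) ≟ x)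
    ⊔-distribˡ-⊓ : ∀ x y z → x ⊔ y ⊓ z ≡ (x ⊔ y) ⊓ (x ⊔ z)
    ⊔-distribˡ-⊓ = from-yes (all? λ x → all? λ y → all? λ z → x ⊔ y ⊓ z ≟ (x ⊔ y) ⊓ (x ⊔ z))
    ⊔-distribʳ-⊓ : ∀ x y z → y ⊓ z ⊔ x ≡ (y ⊔ x) ⊓ (z ⊔ x)
    ⊔-distribʳ-⊓ = from-yes (all? λ x → all? λ y → all? λ z → y ⊓ z ⊔ x ≟ (y ⊔ x) ⊓ (z ⊔ x))
    ⊓-distribˡ-⊔ : ∀ x y z → x ⊓ (y ⊔ z) ≡ x ⊓ y ⊔ x ⊓ z
    ⊓-distribˡ-⊔ = from-yes (all? λ x → all? λ y → all? λ z → x ⊓ (y ⊔ z) ≟ x ⊓ y ⊔ x ⊓ z)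
    ⊓-distribʳ-⊔ : ∀ x y z → (y ⊔ z) ⊓ x ≡ y ⊓ x ⊔ z ⊓ x
    ⊓-distribʳ-⊔ = from-yes (all? λ x → all? λ y → all? λ z → (y ⊔ z) ⊓ x ≟ y ⊓ x ⊔ z ⊓ x)
    opposite-involutive : ∀ x → opposite (opposite x) ≡ x
    opposite-involutive = from-yes (all? λ (x : Fin 3) → opposite (opposite x) ≟ x)
    opposite-⊓ : ∀ x y → opposite (x ⊓ y) ≡ opposite x ⊔ opposite y
    opposite-⊓ = from-yes (all? λ x → all? λ y → opposite (x ⊓ y) ≟ opposite x ⊔ opposite y)
    x⊓∇₃x≡x : ∀ x → x ⊓ ∇₃ x ≡ x
    x⊓∇₃x≡x = from-yes (all? λ x → x ⊓ ∇₃ x ≟ x)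
    ∇₃-⊓ : ∀ x y → ∇₃ (x ⊓ y) ≡ ∇₃ x ⊓ ∇₃ y
    ∇₃-⊓ = from-yes (all? λ x → all? λ y → ∇₃ (x ⊓ y) ≟ ∇₃ x ⊓ ∇₃ y)
    opposite∇₃x⊓∇₃x≡0 : ∀ x → opposite (∇₃ x) ⊓ ∇₃ x ≡ 0₃
    opposite∇₃x⊓∇₃x≡0 = from-yes (all? λ x → opposite (∇₃ x) ⊓ ∇₃ x ≟ 0₃)

  ⊭-at-½ : {c ℓ : Level} (α β : Fm) →
    lower (⟦ K₃ c ℓ ⟧ α (λ _ → lift ½)) ≡ 1₃ → lower (⟦ K₃ c ℓ ⟧ β (λ _ → lift ½)) ≢ 1₃ →
    ¬ α ⊨[ c , ℓ ] β
  ⊭-at-½ α β α≡1 β≢1 =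
    ⊭-by-valuation α β (K₃ _ _) (λ _ → lift ½) (lift α≡1) λ (lift β≡1) → β≢1 β≡1

open ThreeElementChain using (⊭-at-½)

mainTheorem6 : {c ℓ : Level} →
    -- (i)
    ((α : Fm) → (α ∧ᶠ ¬ᶠ α) ⊨[ c , ℓ ] •ᶠ α)
    × ((p : ℕ) → ¬ (•ᶠ (var p) ⊨[ c , ℓ ] (var p ∧ᶠ ¬ᶠ (var p))))
    -- (ii)
    × ((α : Fm) → (•ᶠ α ⊨[ c , ℓ ] •ᶠ (¬ᶠ α)) × (•ᶠ (¬ᶠ α) ⊨[ c , ℓ ] •ᶠ α))
    -- (iii)
    × ((α β : Fm) → •ᶠ (α ∧ᶠ β) ⊨[ c , ℓ ] (•ᶠ α ∨ᶠ •ᶠ β))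
    × ((α β : Fm) → •ᶠ (α ∨ᶠ β) ⊨[ c , ℓ ] (•ᶠ α ∨ᶠ •ᶠ β))
    × (Σ[ α ∈ Fm ] Σ[ β ∈ Fm ] ¬ ((•ᶠ α ∨ᶠ •ᶠ β) ⊨[ c , ℓ ] •ᶠ (α ∧ᶠ β)))
    × (Σ[ α ∈ Fm ] Σ[ β ∈ Fm ] ¬ ((•ᶠ α ∨ᶠ •ᶠ β) ⊨[ c , ℓ ] •ᶠ (α ∨ᶠ β)))
mainTheorem6 {c} {ℓ} =
    (λ α → ≤⇒⊨ (α ∧ᶠ ¬ᶠ α) (•ᶠ α) λ A v → P.x∧~x≤•x A (⟦ A ⟧ α v))
  , (λ p → ⊭-at-½ (•ᶠ (var p)) (var p ∧ᶠ ¬ᶠ var p) ≡.refl λ ())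
  , (λ α → ≤⇒⊨ (•ᶠ α) (•ᶠ (¬ᶠ α)) (λ A v → P.≤-reflexive A (sym A (P.•~x≈•x A (⟦ A ⟧ α v))))
         , ≤⇒⊨ (•ᶠ (¬ᶠ α)) (•ᶠ α) (λ A v → P.≤-reflexive A (P.•~x≈•x A (⟦ A ⟧ α v))))
  , (λ α β → ≤⇒⊨ (•ᶠ (α ∧ᶠ β)) (•ᶠ α ∨ᶠ •ᶠ β)
               λ A v → P.•[x∧y]≤•x∨•y A (⟦ A ⟧ α v) (⟦ A ⟧ β v))
  , (λ α β → ≤⇒⊨ (•ᶠ (α ∨ᶠ β)) (•ᶠ α ∨ᶠ •ᶠ β)
               λ A v → P.•[x∨y]≤•x∨•y A (⟦ A ⟧ α v) (⟦ A ⟧ β v))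
  , (var 0 , ⊥ᶠ , ⊭-at-½ (•ᶠ (var 0) ∨ᶠ •ᶠ ⊥ᶠ) (•ᶠ (var 0 ∧ᶠ ⊥ᶠ)) ≡.refl λ ())
  , (var 0 , ⊤ᶠ , ⊭-at-½ (•ᶠ (var 0) ∨ᶠ •ᶠ ⊤ᶠ) (•ᶠ (var 0 ∨ᶠ ⊤ᶠ)) ≡.refl λ ())
  where
  module P = InvolutiveStoneAlgebraProperties
  open InvolutiveStoneAlgebra using (sym)
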